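{- The ideal $\mathcal Z$ of subsets of $\omega$ of asymptotic density $0$ is not an HL ideal.
   Context: $\mathcal Z=\{A\subseteq\omega:\lim_{n\to\infty}|A\cap n|/n=0\}$. A tree is an initial subset of $(2^{<\omega},\subseteq)$ without maximal elements, perfect if every node has two incompatible extensions in it; $\mathbf S$ is the set of perfect trees; $p\restriction A=\{s\in p\cap2^n:n\in A\}$. An ideal $\mathcal I$ on $\omega$ is HL if for every $c:2^{<\omega}\to2$ there are $p\in\mathbf S$ and $A\in\mathcal I^+=\mathcal P(\omega)\setminus\mathcal I$ with $c$ constant on $p\restriction A$. -}

module Defs where

open import Data.Nat using (ℕ; zero; suc; _+_; _*_; _≤_)
open import Data.Bool using (Bool; true; false)
open import Data.List using (List; []; _∷_; _++_; length)
open import Data.Product using (Σ; ∃; _×_; _,_)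
open import Relation.Nullary using (¬_)
open import Relation.Binary.PropositionalEquality using (_≡_)

Subset : Set
Subset = ℕ → Bool

count : Subset → ℕ → ℕ
count A zero = zero
count A (suc n) with A n
... | true  = suc (count A n)
... | false = count A n

-- A ∈ 𝒵  iff  lim |A∩n|/n = 0, i.e. for every k there is N with
-- (k+1)·|A∩n| ≤ n for all n ≥ N.
InZ : Subset → Set
InZ A = ∀ (k : ℕ) → ∃ λ (N : ℕ) → ∀ (n : ℕ) → N ≤ n → suc k * count A n ≤ n

Seq : Set
Seq = List Bool

_⊑_ : Seq → Seq → Set
s ⊑ t = ∃ λ u → s ++ u ≡ t

_⊏_ : Seq → Seq → Set
s ⊏ t = s ⊑ t × ¬ (s ≡ t)

Compatible : Seq → Seq → Set
Compatible s t = (s ⊑ t) Data.Sum.⊎ (t ⊑ s)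
  where import Data.Sum

record IsTree (p : Seq → Set) : Set where
  field
    root    : p []
    initial : ∀ s t → s ⊑ t → p t → p s
    nomax   : ∀ s → p s → ∃ λ t → s ⊏ t × p t

record IsPerfect (p : Seq → Set) : Set where
  field
    tree    : IsTree p
    split   : ∀ s → p s → ∃ λ t → ∃ λ u →
                s ⊑ t × s ⊑ u × p t × p u × ¬ Compatible t u

HL : (Subset → Set) → Set₁
HL I = ∀ (c : Seq → Bool) →
  Σ (Seq → Set) λ p → IsPerfect p ×
  Σ Subset λ A → ¬ I A ×
  Σ Bool λ i → ∀ s → p s → A (length s) ≡ true → c s ≡ i

-- Colour s by ⟨s, |s|⟩, the parity of the digits of s at the positions of the
-- 1-digits of the binary expansion of |s|. The pairing is additive in s, so if
-- the colour is constant on p↾A, then ⟨x ⊕ y, n⟩ = 0 for any two branches x, y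
-- of p and every n ∈ A. Splitting p k times produces differences d₁, …, d_k
-- whose first 1-digits sit at strictly increasing positions, and the set of n
-- with ⟨dⱼ, n⟩ = 0 for all j has upper density at most 2⁻ᵏ: sorting n by
-- parity, a difference with first digit at position 0 separates 2a from
-- 2a + 1, while for the others both halves look like the same problem with all
-- digits shifted down. As k is arbitrary, A has density 0.
module Submission where

open import Defs
open import Algebra.Bundles using (CommutativeRing)
open import Data.Bool using (Bool; true; false; not; _∧_; _xor_)
open import Data.Bool.Properties using (xor-same; xor-inverseʳ; ¬-not; xor-∧-commutativeRing)
  renaming (_≟_ to _≟ᵇ_)
open import Data.Empty using (⊥-elim)
open import Data.List using (List; []; _∷_; _++_; length; applyUpTo)
open import Data.List.Properties using (length-applyUpTo; ++-identityʳ; ++-assoc; length-++)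
open import Data.Nat using (ℕ; zero; suc; _+_; _*_; _^_; _≤_; _<_; _≤′_; ≤′-refl; ≤′-step; z≤n; s≤s; ⌈_/2⌉; _≤?_)
open import Data.Nat.Properties
open import Data.Nat.Tactic.RingSolver using (solve-∀)
open import Data.Product using (Σ; ∃; _×_; _,_; proj₁; proj₂)
open import Data.Sum using (inj₁; inj₂)
open import Data.Vec using (Vec; []; _∷_)
import Data.Vec as Vec
open import Function using (_∘_)
open import Relation.Nullary using (¬_; yes; no; contradiction)
open import Relation.Binary.PropositionalEquality

open import Algebra.Properties.CommutativeSemigroup +-commutativeSemigroup
  using () renaming (interchange to +-interchange)
open import Algebra.Properties.CommutativeSemigroup
  (CommutativeRing.+-commutativeSemigroup xor-∧-commutativeRing)
  using () renaming (interchange to xor-interchange)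

-- Binary expansions and the colouring

Cantor : Set
Cantor = ℕ → Bool

shift : Cantor → Cantor
shift x = x ∘ suc

_⊕_ : Cantor → Cantor → Cantor
(x ⊕ y) l = x l xor y l

double : ℕ → ℕ
double zero = zero
double (suc a) = suc (suc (double a))

double≡+ : ∀ a → double a ≡ a + a
double≡+ zero = refl
double≡+ (suc a) = cong suc (trans (cong suc (double≡+ a)) (sym (+-suc a a)))

≤-double-⌈/2⌉ : ∀ n → n ≤ double ⌈ n /2⌉
≤-double-⌈/2⌉ zero = z≤n
≤-double-⌈/2⌉ (suc zero) = s≤s z≤n
≤-double-⌈/2⌉ (suc (suc n)) = s≤s (s≤s (≤-double-⌈/2⌉ n))

double-⌈/2⌉≤ : ∀ n → double ⌈ n /2⌉ ≤ suc n
double-⌈/2⌉≤ zero = z≤n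
double-⌈/2⌉≤ (suc zero) = ≤-refl
double-⌈/2⌉≤ (suc (suc n)) = s≤s (s≤s (double-⌈/2⌉≤ n))

suc≤2^ : ∀ k → suc k ≤ 2 ^ k
suc≤2^ zero = ≤-refl
suc≤2^ (suc k) = +-mono-≤ (m^n>0 2 k) (≤-trans (suc≤2^ k) (m≤m+n (2 ^ k) 0))

-- Binary expansions are little-endian: the least significant digit comes first.
increment : List Bool → List Bool
increment [] = true ∷ []
increment (false ∷ bs) = true ∷ bs
increment (true ∷ bs) = false ∷ increment bs

bits : ℕ → List Bool
bits zero = []
bits (suc n) = increment (bits n)

bits-odd : ∀ a → bits (suc (double a)) ≡ true ∷ bits a
bits-odd zero = refl
bits-odd (suc a) = cong (increment ∘ increment) (bits-odd a)

bits-even : ∀ a → bits (double (suc a)) ≡ false ∷ bits (suc a)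
bits-even a = cong increment (bits-odd a)

length-increment : ∀ bs → length (increment bs) ≤ suc (length bs)
length-increment [] = ≤-refl
length-increment (false ∷ bs) = n≤1+n _
length-increment (true ∷ bs) = s≤s (length-increment bs)

length-bits : ∀ n → length (bits n) ≤ n
length-bits zero = z≤n
length-bits (suc n) = ≤-trans (length-increment (bits n)) (s≤s (length-bits n))

dot : Cantor → List Bool → Bool
dot x [] = false
dot x (b ∷ bs) = (b ∧ x 0) xor dot (shift x) bs

⟨_∣_⟩ : Cantor → ℕ → Bool
⟨ x ∣ n ⟩ = dot x (bits n)

dot-⊕ : ∀ x y bs → dot (x ⊕ y) bs ≡ dot x bs xor dot y bs
dot-⊕ x y [] = refl
dot-⊕ x y (false ∷ bs) = dot-⊕ (shift x) (shift y) bs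
dot-⊕ x y (true ∷ bs) =
  trans (cong ((x 0 xor y 0) xor_) (dot-⊕ (shift x) (shift y) bs))
        (xor-interchange (x 0) (y 0) (dot (shift x) bs) (dot (shift y) bs))

dot-cong : ∀ x y bs → (∀ l → l < length bs → x l ≡ y l) → dot x bs ≡ dot y bs
dot-cong x y [] x≗y = refl
dot-cong x y (b ∷ bs) x≗y =
  cong₂ (λ z w → (b ∧ z) xor w) (x≗y 0 (s≤s z≤n))
        (dot-cong (shift x) (shift y) bs (λ l l< → x≗y (suc l) (s≤s l<)))

⟨∣⟩-even : ∀ x a → ⟨ x ∣ double a ⟩ ≡ ⟨ shift x ∣ a ⟩
⟨∣⟩-even x zero = refl
⟨∣⟩-even x (suc a) = cong (dot x) (bits-even a)

⟨∣⟩-odd : ∀ x a → ⟨ x ∣ suc (double a) ⟩ ≡ x 0 xor ⟨ shift x ∣ a ⟩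
⟨∣⟩-odd x a = cong (dot x) (bits-odd a)

-- Reading a finite sequence as a point of Cantor space, padded with false.
_!_ : Seq → ℕ → Bool
[] ! l = false
(b ∷ s) ! zero = b
(b ∷ s) ! suc l = s ! l

colour : Seq → Bool
colour s = ⟨ s !_ ∣ length s ⟩

applyUpTo-! : ∀ x n l → l < n → applyUpTo x n ! l ≡ x l
applyUpTo-! x (suc n) zero _ = refl
applyUpTo-! x (suc n) (suc l) (s≤s l<n) = applyUpTo-! (shift x) n l l<n

colour-applyUpTo : ∀ x n → colour (applyUpTo x n) ≡ ⟨ x ∣ n ⟩
colour-applyUpTo x n = begin
  dot (applyUpTo x n !_) (bits (length (applyUpTo x n)))
    ≡⟨ cong (dot (applyUpTo x n !_) ∘ bits) (length-applyUpTo x n) ⟩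
  dot (applyUpTo x n !_) (bits n)
    ≡⟨ dot-cong _ x (bits n) (λ l l< → applyUpTo-! x n l (≤-trans l< (length-bits n))) ⟩
  ⟨ x ∣ n ⟩ ∎
  where open ≡-Reasoning

-- Counting and upper density

indicator : Bool → ℕ
indicator true = 1
indicator false = 0

_⊆_ : Subset → Subset → Set
A ⊆ B = ∀ n → A n ≡ true → B n ≡ true

≗⇒⊆ : ∀ {A B : Subset} → (∀ n → A n ≡ B n) → A ⊆ B
≗⇒⊆ A≗B n = trans (sym (A≗B n))

count-suc : ∀ A n → count A (suc n) ≡ indicator (A n) + count A n
count-suc A n with A n
... | true = refl
... | false = refl

count-true : ∀ n → count (λ _ → true) n ≡ n
count-true zero = refl
count-true (suc n) = cong suc (count-true n)

count-mono : ∀ {A B} → A ⊆ B → ∀ n → count A n ≤ count B n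
count-mono A⊆B zero = z≤n
count-mono {A} {B} A⊆B (suc n) rewrite count-suc A n | count-suc B n =
  +-mono-≤ (indicator-mono (A n) (B n) (A⊆B n)) (count-mono A⊆B n)
  where
  indicator-mono : ∀ a b → (a ≡ true → b ≡ true) → indicator a ≤ indicator b
  indicator-mono true b a⇒b rewrite a⇒b refl = ≤-refl
  indicator-mono false b a⇒b = z≤n

count-monoʳ : ∀ A {n m} → n ≤′ m → count A n ≤ count A m
count-monoʳ A ≤′-refl = ≤-refl
count-monoʳ A (≤′-step {m} n≤′m) =
  ≤-trans (count-monoʳ A n≤′m) (≤-trans (m≤n+m _ _) (≤-reflexive (sym (count-suc A m))))

count-sum : ∀ A B C → (∀ a → indicator (A a) + indicator (B a) ≤ indicator (C a)) →
  ∀ n → count A n + count B n ≤ count C n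
count-sum A B C pointwise zero = z≤n
count-sum A B C pointwise (suc n)
  rewrite count-suc A n | count-suc B n | count-suc C n
        | +-interchange (indicator (A n)) (count A n) (indicator (B n)) (count B n) =
  +-mono-≤ (pointwise n) (count-sum A B C pointwise n)

count-double : ∀ A h → count A (double h) ≡ count (A ∘ double) h + count (A ∘ suc ∘ double) h
count-double A zero = refl
count-double A (suc h) = begin
  count A (suc (suc (double h)))
    ≡⟨ trans (count-suc A _) (cong (indicator (A (suc (double h))) +_) (count-suc A _)) ⟩
  odd + (even + count A (double h))
    ≡⟨ cong (λ c → odd + (even + c)) (count-double A h) ⟩
  odd + (even + (count (A ∘ double) h + count (A ∘ suc ∘ double) h))
    ≡⟨ shuffle odd even _ _ ⟩
  (even + count (A ∘ double) h) + (odd + count (A ∘ suc ∘ double) h)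
    ≡⟨ sym (cong₂ _+_ (count-suc (A ∘ double) h) (count-suc (A ∘ suc ∘ double) h)) ⟩
  count (A ∘ double) (suc h) + count (A ∘ suc ∘ double) (suc h) ∎
  where
  open ≡-Reasoning
  odd even : ℕ
  odd = indicator (A (suc (double h)))
  even = indicator (A (double h))
  shuffle : ∀ o e x y → o + (e + (x + y)) ≡ (e + x) + (o + y)
  shuffle = solve-∀

count-halves : ∀ A n → count A n ≤ count (A ∘ double) ⌈ n /2⌉ + count (A ∘ suc ∘ double) ⌈ n /2⌉
count-halves A n =
  ≤-trans (count-monoʳ A (≤⇒≤′ (≤-double-⌈/2⌉ n))) (≤-reflexive (count-double A ⌈ n /2⌉))

-- Upper density at most 2⁻ᵏ, with an additive error.
record Sparse (k : ℕ) (A : Subset) : Set where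
  constructor _,_
  field
    error : ℕ
    bound : ∀ n → 2 ^ k * count A n ≤ n + error

Sparse-full : Sparse 0 (λ _ → true)
Sparse-full = 0 , λ n → ≤-reflexive (trans (*-identityˡ _) (trans (count-true n) (sym (+-identityʳ n))))

Sparse-mono : ∀ {k A B} → A ⊆ B → Sparse k B → Sparse k A
Sparse-mono {k} A⊆B (E , bound) = E , λ n → ≤-trans (*-monoʳ-≤ (2 ^ k) (count-mono A⊆B n)) (bound n)

Sparse-fromHalves : ∀ k A E →
  (∀ h → 2 ^ k * (count (A ∘ double) h + count (A ∘ suc ∘ double) h) ≤ (h + h) + E) → Sparse k A
Sparse-fromHalves k A E bound = suc E , λ n → begin
  2 ^ k * count A n
    ≤⟨ *-monoʳ-≤ (2 ^ k) (count-halves A n) ⟩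
  2 ^ k * (count (A ∘ double) ⌈ n /2⌉ + count (A ∘ suc ∘ double) ⌈ n /2⌉)
    ≤⟨ bound ⌈ n /2⌉ ⟩
  (⌈ n /2⌉ + ⌈ n /2⌉) + E
    ≡⟨ cong (_+ E) (sym (double≡+ ⌈ n /2⌉)) ⟩
  double ⌈ n /2⌉ + E
    ≤⟨ +-monoˡ-≤ E (double-⌈/2⌉≤ n) ⟩
  suc n + E
    ≡⟨ sym (+-suc n E) ⟩
  n + suc E ∎
  where open ≤-Reasoning

Sparse-merge : ∀ {k A} → Sparse k (A ∘ double) → Sparse k (A ∘ suc ∘ double) → Sparse k A
Sparse-merge {k} {A} (E₁ , bound₁) (E₂ , bound₂) = Sparse-fromHalves k A (E₁ + E₂) λ h → begin
  2 ^ k * (count (A ∘ double) h + count (A ∘ suc ∘ double) h)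
    ≡⟨ *-distribˡ-+ (2 ^ k) _ _ ⟩
  2 ^ k * count (A ∘ double) h + 2 ^ k * count (A ∘ suc ∘ double) h
    ≤⟨ +-mono-≤ (bound₁ h) (bound₂ h) ⟩
  (h + E₁) + (h + E₂)
    ≡⟨ +-interchange h E₁ h E₂ ⟩
  (h + h) + (E₁ + E₂) ∎
  where open ≤-Reasoning

Sparse-halve : ∀ {k A B} →
  (∀ a → indicator (A (double a)) + indicator (A (suc (double a))) ≤ indicator (B a)) →
  Sparse k B → Sparse (suc k) A
Sparse-halve {k} {A} {B} pointwise (E , bound) = Sparse-fromHalves (suc k) A (E + E) λ h → begin
  2 ^ suc k * (count (A ∘ double) h + count (A ∘ suc ∘ double) h)
    ≡⟨ *-assoc 2 (2 ^ k) _ ⟩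
  2 * (2 ^ k * (count (A ∘ double) h + count (A ∘ suc ∘ double) h))
    ≤⟨ *-monoʳ-≤ 2 (*-monoʳ-≤ (2 ^ k) (count-sum _ _ B pointwise h)) ⟩
  2 * (2 ^ k * count B h)
    ≤⟨ *-monoʳ-≤ 2 (bound h) ⟩
  2 * (h + E)
    ≡⟨ twice h E ⟩
  (h + h) + (E + E) ∎
  where
  open ≤-Reasoning
  twice : ∀ h E → 2 * (h + E) ≡ (h + h) + (E + E)
  twice = solve-∀

Sparse-all⇒InZ : ∀ {A} → (∀ k → Sparse k A) → InZ A
Sparse-all⇒InZ {A} sparse k with sparse (suc k)
... | E , bound = E , λ n E≤n → *-cancelˡ-≤ 2 (begin
  2 * (suc k * count A n)
    ≤⟨ *-monoʳ-≤ 2 (*-monoˡ-≤ (count A n) (suc≤2^ k)) ⟩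
  2 * (2 ^ k * count A n)
    ≡⟨ sym (*-assoc 2 (2 ^ k) _) ⟩
  2 ^ suc k * count A n
    ≤⟨ bound n ⟩
  n + E
    ≤⟨ +-monoʳ-≤ n E≤n ⟩
  n + n
    ≡⟨ cong (n +_) (sym (+-identityʳ n)) ⟩
  2 * n ∎)
  where open ≤-Reasoning

-- Annihilators of echelon families

Annihilator : ∀ {k} → Vec Cantor k → Subset
Annihilator [] n = true
Annihilator (d ∷ D) n = not ⟨ d ∣ n ⟩ ∧ Annihilator D n

FirstOneAt : Cantor → ℕ → Set
FirstOneAt d m = (∀ l → l < m → d l ≡ false) × d m ≡ true

data Echelon (lb : ℕ) : ∀ {k} → Vec Cantor k → Set where
  [] : Echelon lb []
  pivot : ∀ {k d} {D : Vec Cantor k} m → lb ≤ m → FirstOneAt d m → Echelon (suc m) D →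
    Echelon lb (d ∷ D)

shiftAll : ∀ {k} → Vec Cantor k → Vec Cantor k
shiftAll = Vec.map shift

FirstOneAt-shift : ∀ {d m} → FirstOneAt d (suc m) → FirstOneAt (shift d) m
FirstOneAt-shift (zeros , one) = (λ l l<m → zeros (suc l) (s≤s l<m)) , one

Echelon-shift : ∀ {lb k} {D : Vec Cantor k} → Echelon (suc lb) D → Echelon lb (shiftAll D)
Echelon-shift [] = []
Echelon-shift (pivot (suc m) (s≤s lb≤m) first rest) =
  pivot m lb≤m (FirstOneAt-shift first) (Echelon-shift rest)

Annihilator-even : ∀ {k} (D : Vec Cantor k) a → Annihilator D (double a) ≡ Annihilator (shiftAll D) a
Annihilator-even [] a = refl
Annihilator-even (d ∷ D) a = cong₂ (λ x y → not x ∧ y) (⟨∣⟩-even d a) (Annihilator-even D a)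

Annihilator-odd : ∀ {lb k} {D : Vec Cantor k} → Echelon (suc lb) D →
  ∀ a → Annihilator D (suc (double a)) ≡ Annihilator (shiftAll D) a
Annihilator-odd [] a = refl
Annihilator-odd {D = d ∷ _} (pivot (suc m) _ (zeros , _) rest) a =
  cong₂ (λ x y → not x ∧ y)
    (trans (⟨∣⟩-odd d a) (cong (_xor ⟨ shift d ∣ a ⟩) (zeros 0 (s≤s z≤n))))
    (Annihilator-odd rest a)

Annihilator-pair : ∀ {lb k d} {D : Vec Cantor k} → d 0 ≡ true → Echelon (suc lb) D → ∀ a →
  indicator (Annihilator (d ∷ D) (double a)) + indicator (Annihilator (d ∷ D) (suc (double a)))
    ≤ indicator (Annihilator (shiftAll D) a)
Annihilator-pair {d = d} {D} d0 rest a
  rewrite ⟨∣⟩-even d a | ⟨∣⟩-odd d a | d0 | Annihilator-even D a | Annihilator-odd rest a =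
  at-most-one ⟨ shift d ∣ a ⟩ (Annihilator (shiftAll D) a)
  where
  at-most-one : ∀ x w → indicator (not x ∧ w) + indicator (not (not x) ∧ w) ≤ indicator w
  at-most-one true w = ≤-refl
  at-most-one false true = ≤-refl
  at-most-one false false = ≤-refl

Sparse-Annihilator : ∀ {lb k} {D : Vec Cantor k} → Echelon lb D → Sparse k (Annihilator D)
Sparse-Annihilator-pivot : ∀ {k d} {D : Vec Cantor k} m → FirstOneAt d m → Echelon (suc m) D →
  Sparse (suc k) (Annihilator (d ∷ D))

Sparse-Annihilator [] = Sparse-full
Sparse-Annihilator (pivot m _ first rest) = Sparse-Annihilator-pivot m first rest

Sparse-Annihilator-pivot zero (_ , d0) rest =
  Sparse-halve (Annihilator-pair d0 rest) (Sparse-Annihilator (Echelon-shift rest))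
Sparse-Annihilator-pivot {d = d} {D} (suc m) first rest =
  Sparse-merge (Sparse-mono (≗⇒⊆ (Annihilator-even (d ∷ D))) shifted)
               (Sparse-mono (≗⇒⊆ (Annihilator-odd (pivot (suc m) (s≤s z≤n) first rest))) shifted)
  where
  shifted : Sparse _ (Annihilator (shiftAll (d ∷ D)))
  shifted = Sparse-Annihilator-pivot m (FirstOneAt-shift first) (Echelon-shift rest)

-- Branches of perfect trees

⊑-refl : ∀ s → s ⊑ s
⊑-refl s = [] , ++-identityʳ s

⊑-trans : ∀ {s t w} → s ⊑ t → t ⊑ w → s ⊑ w
⊑-trans {s} (u , refl) (v , refl) = u ++ v , sym (++-assoc s u v)

⊏⇒length< : ∀ {s t} → s ⊏ t → length s < length t
⊏⇒length< {s} (([] , refl) , s≢t) = ⊥-elim (s≢t (sym (++-identityʳ s)))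
⊏⇒length< {s} ((b ∷ u , refl) , _) rewrite length-++ s {b ∷ u} =
  ≤-trans (m≤m+n (suc (length s)) (length u)) (≤-reflexive (sym (+-suc (length s) (length u))))

!-⊑ : ∀ {s t} l → s ⊑ t → l < length s → s ! l ≡ t ! l
!-⊑ {b ∷ s} zero (u , refl) _ = refl
!-⊑ {b ∷ s} (suc l) (u , refl) (s≤s l<s) = !-⊑ {s} l (u , refl) l<s

applyUpTo-⊑ : ∀ x n t → n ≤ length t → (∀ l → l < n → x l ≡ t ! l) → applyUpTo x n ⊑ t
applyUpTo-⊑ x zero t _ _ = t , refl
applyUpTo-⊑ x (suc n) (b ∷ t) (s≤s n≤t) x≗t
  with applyUpTo-⊑ (shift x) n t n≤t (λ l l<n → x≗t (suc l) (s≤s l<n))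
... | u , eq = u , cong₂ _∷_ (x≗t 0 (s≤s z≤n)) eq

incompatible⇒FirstOneAt : ∀ t u → ¬ Compatible t u →
  ∃ λ m → m < length t × m < length u × FirstOneAt ((t !_) ⊕ (u !_)) m
incompatible⇒FirstOneAt [] u t#u = ⊥-elim (t#u (inj₁ (u , refl)))
incompatible⇒FirstOneAt (a ∷ t) [] t#u = ⊥-elim (t#u (inj₂ (a ∷ t , refl)))
incompatible⇒FirstOneAt (a ∷ t) (b ∷ u) t#u with a ≟ᵇ b
... | no a≢b = 0 , s≤s z≤n , s≤s z≤n , (λ _ ()) , trans (cong (a xor_) (¬-not (a≢b ∘ sym))) (xor-inverseʳ a)
... | yes refl with incompatible⇒FirstOneAt t u tail-incompatible
  where
  tail-incompatible : ¬ Compatible t u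
  tail-incompatible (inj₁ (w , eq)) = t#u (inj₁ (w , cong (a ∷_) eq))
  tail-incompatible (inj₂ (w , eq)) = t#u (inj₂ (w , cong (a ∷_) eq))
... | m , m<t , m<u , zeros , one = suc m , s≤s m<t , s≤s m<u , zeros′ , one
  where
  zeros′ : ∀ l → l < suc m → ((a ∷ t) ! l) xor ((a ∷ u) ! l) ≡ false
  zeros′ zero _ = xor-same a
  zeros′ (suc l) (s≤s l<m) = zeros l l<m

FirstOneAt-beyond : ∀ {s t u m} → s ⊑ t → s ⊑ u → FirstOneAt ((t !_) ⊕ (u !_)) m → length s ≤ m
FirstOneAt-beyond {s} {t} {u} {m} s⊑t s⊑u (_ , one) with length s ≤? m
... | yes s≤m = s≤m
... | no s≰m = contradiction (trans (sym (agree (≰⇒> s≰m))) one) λ ()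
  where
  agree : m < length s → (t ! m) xor (u ! m) ≡ false
  agree m<s = trans (cong₂ _xor_ (sym (!-⊑ m s⊑t m<s)) (sym (!-⊑ m s⊑u m<s))) (xor-same (s ! m))

FirstOneAt-cong : ∀ {d e m} → (∀ l → l ≤ m → d l ≡ e l) → FirstOneAt d m → FirstOneAt e m
FirstOneAt-cong d≗e (zeros , one) =
  (λ l l<m → trans (sym (d≗e l (<⇒≤ l<m))) (zeros l l<m)) , trans (sym (d≗e _ ≤-refl)) one

module Branches {p : Seq → Set} (perfect : IsPerfect p) where
  open IsTree (IsPerfect.tree perfect)

  Node : Set
  Node = Σ Seq p

  extend : Node → Node
  extend (s , ps) with nomax s ps
  ... | t , _ , pt = t , pt

  extend-⊏ : ∀ x → proj₁ x ⊏ proj₁ (extend x)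
  extend-⊏ (s , ps) with nomax s ps
  ... | _ , s⊏t , _ = s⊏t

  path : Node → ℕ → Node
  path x zero = x
  path x (suc i) = extend (path x i)

  ≤-length-path : ∀ x i → i ≤ length (proj₁ (path x i))
  ≤-length-path x zero = z≤n
  ≤-length-path x (suc i) = ≤-<-trans (≤-length-path x i) (⊏⇒length< (extend-⊏ (path x i)))

  path-⊑ : ∀ x {i j} → i ≤′ j → proj₁ (path x i) ⊑ proj₁ (path x j)
  path-⊑ x ≤′-refl = ⊑-refl _
  path-⊑ x (≤′-step {j} i≤′j) = ⊑-trans (path-⊑ x i≤′j) (proj₁ (extend-⊏ (path x j)))

  branch : Node → Cantor
  branch x l = proj₁ (path x (suc l)) ! l

  branch-agrees : ∀ x i l → l < length (proj₁ (path x i)) → branch x l ≡ proj₁ (path x i) ! l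
  branch-agrees x i l l<len with ≤-total (suc l) i
  ... | inj₁ l<i = !-⊑ l (path-⊑ x (≤⇒≤′ l<i)) (≤-length-path x (suc l))
  ... | inj₂ i≤l+1 = sym (!-⊑ l (path-⊑ x (≤⇒≤′ i≤l+1)) l<len)

  branch-extends : ∀ x l → l < length (proj₁ x) → branch x l ≡ proj₁ x ! l
  branch-extends x = branch-agrees x 0

  branch-∈ : ∀ x n → p (applyUpTo (branch x) n)
  branch-∈ x n = initial _ (proj₁ (path x n))
    (applyUpTo-⊑ (branch x) n _ (≤-length-path x n)
      (λ l l<n → branch-agrees x n l (≤-trans l<n (≤-length-path x n))))
    (proj₂ (path x n))

module _ {p : Seq → Set} (perfect : IsPerfect p) {A : Subset} {i : Bool}
         (homogeneous : ∀ s → p s → A (length s) ≡ true → colour s ≡ i) where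
  open IsPerfect perfect
  open IsTree tree
  open Branches perfect

  ⟨branch∣⟩ : ∀ x n → A n ≡ true → ⟨ branch x ∣ n ⟩ ≡ i
  ⟨branch∣⟩ x n n∈A = trans (sym (colour-applyUpTo (branch x) n))
    (homogeneous _ (branch-∈ x n) (trans (cong A (length-applyUpTo (branch x) n)) n∈A))

  A⊆Annihilator-branch-difference : ∀ x y → A ⊆ (λ n → not ⟨ branch x ⊕ branch y ∣ n ⟩)
  A⊆Annihilator-branch-difference x y n n∈A = cong not (begin
    ⟨ branch x ⊕ branch y ∣ n ⟩              ≡⟨ dot-⊕ (branch x) (branch y) (bits n) ⟩
    ⟨ branch x ∣ n ⟩ xor ⟨ branch y ∣ n ⟩   ≡⟨ cong₂ _xor_ (⟨branch∣⟩ x n n∈A) (⟨branch∣⟩ y n n∈A) ⟩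
    i xor i                                  ≡⟨ xor-same i ⟩
    false ∎)
    where open ≡-Reasoning

  echelon-above : ∀ k s → p s → Σ (Vec Cantor k) λ D → Echelon (length s) D × A ⊆ Annihilator D
  echelon-above zero s ps = [] , [] , λ _ _ → refl
  echelon-above (suc k) s ps with split s ps
  ... | t , u , s⊑t , s⊑u , pt , pu , t#u with incompatible⇒FirstOneAt t u t#u
  ... | m , m<t , m<u , first
    -- recursing above a node of length m + 1 pushes all later pivots past m
    with echelon-above k (applyUpTo (branch (t , pt)) (suc m)) (branch-∈ (t , pt) (suc m))
  ... | D , echelon , A⊆D =
    d ∷ D , pivot m (FirstOneAt-beyond s⊑t s⊑u first) first′ echelon′ , A⊆dD
    where
    d : Cantor
    d = branch (t , pt) ⊕ branch (u , pu)
    first′ : FirstOneAt d m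
    first′ = FirstOneAt-cong (λ l l≤m → sym (cong₂ _xor_
      (branch-extends (t , pt) l (≤-<-trans l≤m m<t)) (branch-extends (u , pu) l (≤-<-trans l≤m m<u))))
      first
    echelon′ : Echelon (suc m) D
    echelon′ = subst (λ lb → Echelon lb D) (length-applyUpTo (branch (t , pt)) (suc m)) echelon
    A⊆dD : A ⊆ Annihilator (d ∷ D)
    A⊆dD n n∈A = cong₂ _∧_ (A⊆Annihilator-branch-difference (t , pt) (u , pu) n n∈A) (A⊆D n n∈A)

  A∈Z : InZ A
  A∈Z = Sparse-all⇒InZ λ k → let (D , echelon , A⊆D) = echelon-above k [] root
                               in Sparse-mono A⊆D (Sparse-Annihilator echelon)

theorem3p16 : ¬ HL InZ
theorem3p16 hl with hl colour
... | p , perfect , A , A∉Z , i , homogeneous = A∉Z (A∈Z perfect homogeneous)
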